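{- Consider the following non-adaptive randomized algorithm, given $V$ with $|V|=n$, CC-oracle access to a hidden graph $G$ on $V$, and an integer $k$ that is an upper bound on the treewidth of $G$: initialize $H$ to the complete graph on $V$; then $t=\mathcal{O}(k^2\log n)$ times (with a suitable constant), independently sample $Q\subseteq V$ by including each vertex independently with probability $1/(k+1)$, query $\mathcal{C}=\mathrm{CC}(Q)$, and remove from $H$ every edge $uv$ with $u,v\in Q$ in different components of $\mathcal{C}$; output $H$. This algorithm performs $\mathcal{O}(k^2\log n)$ CC queries and returns a graph $H$ that is a supergraph of $G$ (on the same vertex set) and, with high probability, has treewidth at most $k$.
   Context: A CC oracle, on query $S\subseteq V$, returns the partition of $S$ into the vertex sets of the connected components of the induced subgraph $G[S]$. "With high probability" means with probability tending to $1$ as $n\to\infty$. Treewidth is the usual notion (minimum width over tree decompositions, width being maximum bag size minus one). -}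

module Defs where

open import Data.Nat using (ℕ; zero; suc; _+_; _*_; _≤_)
open import Data.Fin using (Fin; zero; suc; inject₁; fromℕ)
open import Data.Fin.Subset using (Subset; _∈_; ⊤; ∣_∣)
open import Data.Bool using (Bool; true; false)
open import Data.Vec using (Vec; []; _∷_; lookup)
open import Data.List using (List; []; _∷_; _++_; map; concatMap)
open import Data.Product using (Σ; _×_; _,_)
open import Data.Integer using (+_)
open import Data.Rational using (ℚ; _/_; 0ℚ; 1ℚ) renaming (_+_ to _+ℚ_; _*_ to _*ℚ_)
open import Relation.Binary.PropositionalEquality using (_≡_; _≢_)
open import Relation.Nullary using (¬_)
open import Function.Definitions using (Injective)

Graph : ℕ → Set₁
Graph n = Fin n → Fin n → Set

Symmetric : ∀ {n} → Graph n → Set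
Symmetric {n} G = ∀ (u v : Fin n) → G u v → G v u

Irreflexive : ∀ {n} → Graph n → Set
Irreflexive {n} G = ∀ (u : Fin n) → ¬ G u u

Supergraph : ∀ {n} → Graph n → Graph n → Set
Supergraph {n} G H = ∀ (u v : Fin n) → G u v → H u v

-- ConnIn G S u v : u and v are joined by a walk in the induced subgraph G[S]
-- (all vertices of the walk lie in S). In particular u, v ∈ S.
data ConnIn {n : ℕ} (G : Graph n) (S : Subset n) : Fin n → Fin n → Set where
  here : ∀ {u} → u ∈ S → ConnIn G S u u
  step : ∀ {u w v} → u ∈ S → G u w → ConnIn G S w v → ConnIn G S u v

-- The answer of the CC oracle on query S: the partition of S into the vertex
-- sets of the connected components of G[S]; u and v (both in S) lie in the same
-- part exactly when ConnIn G S u v.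
SameComponent : ∀ {n} → Graph n → Subset n → Fin n → Fin n → Set
SameComponent G S u v = ConnIn G S u v

Connected : ∀ {m} → Graph m → Set
Connected {m} T = ∀ (i j : Fin m) → ConnIn T ⊤ i j

Cycle : ∀ {m} → Graph m → Set
Cycle {m} T =
  Σ ℕ λ l → Σ (Fin (3 + l) → Fin m) λ c →
    Injective _≡_ _≡_ c
    × (∀ (i : Fin (2 + l)) → T (c (inject₁ i)) (c (suc i)))
    × T (c (fromℕ (2 + l))) (c zero)

IsTree : ∀ {m} → Graph m → Set
IsTree T = Symmetric T × Irreflexive T × Connected T × ¬ Cycle T

record TreeDecomposition {n : ℕ} (G : Graph n) : Set₁ where
  field
    m       : ℕ
    T       : Graph (suc m)
    isTree  : IsTree T
    bag     : Fin (suc m) → Subset n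
    covers  : ∀ (v : Fin n) → Σ (Fin (suc m)) λ i → v ∈ bag i
    edges   : ∀ (u v : Fin n) → G u v → Σ (Fin (suc m)) λ i → (u ∈ bag i) × (v ∈ bag i)
    -- for each vertex v, the tree nodes whose bags contain v induce a connected subtree
    subtree : ∀ (v : Fin n) (i j : Fin (suc m)) → v ∈ bag i → v ∈ bag j →
              Σ (Subset (suc m)) λ B →
                (∀ (x : Fin (suc m)) → x ∈ B → v ∈ bag x) × ConnIn T B i j

-- width = maximum bag size minus one
WidthAtMost : ∀ {n} {G : Graph n} → TreeDecomposition G → ℕ → Set
WidthAtMost D k = ∀ i → ∣ TreeDecomposition.bag D i ∣ ≤ suc k

TwAtMost : ∀ {n} → Graph n → ℕ → Set₁
TwAtMost G k = Σ (TreeDecomposition G) λ D → WidthAtMost D k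

-- The random outcome is the sequence ω = (Q₁,…,Q_t) of sampled
-- sets.

Output : ∀ {n t} → Graph n → Vec (Subset n) t → Graph n
Output {n} {t} G ω u v =
  (u ≢ v) × (∀ (i : Fin t) →
    ¬ ((u ∈ lookup ω i) × (v ∈ lookup ω i) × ¬ SameComponent G (lookup ω i) u v))

-- Probability on the finite sample space Vec (Subset n) t, each vertex put
-- into each Q_i independently with probability 1/(k+1).

allVecs : ∀ {A : Set} → List A → (n : ℕ) → List (Vec A n)
allVecs xs zero    = [] ∷ []
allVecs xs (suc n) = concatMap (λ x → map (x ∷_) (allVecs xs n)) xs

subsetWeight : ∀ {n} → ℕ → Subset n → ℚ
subsetWeight k []            = 1ℚ
subsetWeight k (true  ∷ Q)   = ((+ 1) / suc k) *ℚ subsetWeight k Q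
subsetWeight k (false ∷ Q)   = ((+ k) / suc k) *ℚ subsetWeight k Q

outcomeWeight : ∀ {n t} → ℕ → Vec (Subset n) t → ℚ
outcomeWeight k []       = 1ℚ
outcomeWeight k (Q ∷ ω)  = subsetWeight k Q *ℚ outcomeWeight k ω

sumWeights : ∀ {n t} → ℕ → (Vec (Subset n) t → Bool) → List (Vec (Subset n) t) → ℚ
sumWeights k E []       = 0ℚ
sumWeights k E (ω ∷ ωs) with E ω
... | true  = outcomeWeight k ω +ℚ sumWeights k E ωs
... | false = sumWeights k E ωs

Prob : (n k t : ℕ) → (Vec (Subset n) t → Bool) → ℚ
Prob n k t E = sumWeights k E (allVecs (allVecs (true ∷ false ∷ []) n) t)

-- Fix a tree decomposition of G of width at most k. If u and v share no bag, a tree path from a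
-- bag of v to the subtree of bags containing u enters it through an edge ij with u ∈ bag i, and
-- removing ij from the tree cuts the bags of v off from i, so every u–v walk in G meets bag i ∖ {u}.
-- A query Q that contains u and v but no other vertex of bag i therefore removes uv, and a random
-- Q does so with probability at least (k+1)⁻² (k/(k+1))ᵏ ≥ 1/(4(k+1)²). After 12(k+1)²(1 + ⌈log₂ n⌉)
-- queries the probability that one of the n² pairs is never separated is at most 1/n; otherwise
-- every edge of the output lies in a bag, and the same decomposition shows that its treewidth is
-- at most k.
module Submission where

module Sums where

  open import Data.Bool using (Bool; true; false; not; _∧_; _∨_; if_then_else_)
  open import Data.Bool.ListAction using (any)
  open import Data.Bool.Properties using (∨-conicalˡ; ∨-conicalʳ)
  open import Data.Fin using (Fin; zero; suc)
  open import Data.List using (List; []; _∷_; _++_; map; concatMap; length; allFin)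
  open import Data.List.Membership.Propositional using (_∈_)
  open import Data.List.Properties using (length-tabulate)
  open import Data.List.Relation.Unary.Any using (here; there)
  open import Data.Nat
  open import Data.Nat.Properties
  open import Algebra.Properties.CommutativeSemigroup +-commutativeSemigroup
    using () renaming (interchange to +-interchange)
  open import Data.Product using (Σ; _,_)
  open import Data.Vec using (Vec; []; _∷_; lookup)
  open import Function using (_∘_)
  open import Relation.Binary.PropositionalEquality
  open import Defs using (allVecs)

  ∑ : {A : Set} → List A → (A → ℕ) → ℕ
  ∑ []       f = 0
  ∑ (x ∷ xs) f = f x + ∑ xs f

  module _ {A : Set} where

    ∑-cong : ∀ (xs : List A) {f g : A → ℕ} → (∀ x → f x ≡ g x) → ∑ xs f ≡ ∑ xs g
    ∑-cong []       f≡g = refl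
    ∑-cong (x ∷ xs) f≡g = cong₂ _+_ (f≡g x) (∑-cong xs f≡g)

    ∑-mono-≤ : ∀ (xs : List A) {f g : A → ℕ} → (∀ x → f x ≤ g x) → ∑ xs f ≤ ∑ xs g
    ∑-mono-≤ []       f≤g = z≤n
    ∑-mono-≤ (x ∷ xs) f≤g = +-mono-≤ (f≤g x) (∑-mono-≤ xs f≤g)

    ∑-distrib-+ : ∀ (xs : List A) (f g : A → ℕ) → ∑ xs (λ x → f x + g x) ≡ ∑ xs f + ∑ xs g
    ∑-distrib-+ []       f g = refl
    ∑-distrib-+ (x ∷ xs) f g = trans (cong (f x + g x +_) (∑-distrib-+ xs f g))
                                     (+-interchange (f x) (g x) (∑ xs f) (∑ xs g))

    ∑-*ˡ : ∀ (xs : List A) (c : ℕ) (f : A → ℕ) → ∑ xs (λ x → c * f x) ≡ c * ∑ xs f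
    ∑-*ˡ []       c f = sym (*-zeroʳ c)
    ∑-*ˡ (x ∷ xs) c f = trans (cong (c * f x +_) (∑-*ˡ xs c f)) (sym (*-distribˡ-+ c (f x) (∑ xs f)))

    ∑-*ʳ : ∀ (xs : List A) (c : ℕ) (f : A → ℕ) → ∑ xs (λ x → f x * c) ≡ ∑ xs f * c
    ∑-*ʳ []       c f = refl
    ∑-*ʳ (x ∷ xs) c f = trans (cong (f x * c +_) (∑-*ʳ xs c f)) (sym (*-distribʳ-+ c (f x) (∑ xs f)))

    ∑-++ : ∀ (xs ys : List A) (f : A → ℕ) → ∑ (xs ++ ys) f ≡ ∑ xs f + ∑ ys f
    ∑-++ []       ys f = refl
    ∑-++ (x ∷ xs) ys f = trans (cong (f x +_) (∑-++ xs ys f)) (sym (+-assoc (f x) (∑ xs f) (∑ ys f)))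

    ∑-≤-length : ∀ (xs : List A) {f : A → ℕ} {a : ℕ} → (∀ x → f x ≤ a) → ∑ xs f ≤ length xs * a
    ∑-≤-length []       f≤a = z≤n
    ∑-≤-length (x ∷ xs) f≤a = +-mono-≤ (f≤a x) (∑-≤-length xs f≤a)

  module _ {A B : Set} where

    ∑-map : ∀ (g : A → B) (xs : List A) (f : B → ℕ) → ∑ (map g xs) f ≡ ∑ xs (f ∘ g)
    ∑-map g []       f = refl
    ∑-map g (x ∷ xs) f = cong (f (g x) +_) (∑-map g xs f)

    ∑-concatMap : ∀ (g : A → List B) (xs : List A) (f : B → ℕ) →
                  ∑ (concatMap g xs) f ≡ ∑ xs (λ x → ∑ (g x) f)
    ∑-concatMap g []       f = refl
    ∑-concatMap g (x ∷ xs) f = trans (∑-++ (g x) (concatMap g xs) f)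
                                     (cong (∑ (g x) f +_) (∑-concatMap g xs f))

  every : ∀ {A : Set} {n} → (A → Bool) → Vec A n → Bool
  every p []      = true
  every p (x ∷ v) = p x ∧ every p v

  module ProductMeasure {A : Set} (xs : List A) (f : A → ℕ) where

    ∏ : ∀ {n} → Vec A n → ℕ
    ∏ []      = 1
    ∏ (x ∷ v) = f x * ∏ v

    μ : ∀ n → (Vec A n → Bool) → ℕ
    μ n E = ∑ (allVecs xs n) (λ v → if E v then ∏ v else 0)

    μ₁ : (A → Bool) → ℕ
    μ₁ p = ∑ xs (λ x → if p x then f x else 0)

    private
      if-∧-* : ∀ a b m n → (if a ∧ b then m * n else 0) ≡ (if a then m else 0) * (if b then n else 0)
      if-∧-* true  true  m n = refl
      if-∧-* true  false m n = sym (*-zeroʳ m)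
      if-∧-* false b     m n = refl

      if-∨-≤ : ∀ a b m → (if a ∨ b then m else 0) ≤ (if a then m else 0) + (if b then m else 0)
      if-∨-≤ true  b m = m≤m+n m _
      if-∨-≤ false b m = ≤-refl

      if-not-+ : ∀ a m → (if a then m else 0) + (if not a then m else 0) ≡ m
      if-not-+ true  m = +-identityʳ m
      if-not-+ false m = refl

    μ-∷ : ∀ {n} (p : A → Bool) (E : Vec A n → Bool) (E′ : Vec A (suc n) → Bool) →
          (∀ x v → E′ (x ∷ v) ≡ p x ∧ E v) → μ (suc n) E′ ≡ μ₁ p * μ n E
    μ-∷ {n} p E E′ E′≡ = begin
      ∑ (concatMap (λ x → map (x ∷_) vs) xs) g
        ≡⟨ ∑-concatMap (λ x → map (x ∷_) vs) xs g ⟩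
      ∑ xs (λ x → ∑ (map (x ∷_) vs) g)
        ≡⟨ ∑-cong xs (λ x → trans (∑-map (x ∷_) vs g) (∑-cong vs (factor x))) ⟩
      ∑ xs (λ x → ∑ vs (λ v → (if p x then f x else 0) * (if E v then ∏ v else 0)))
        ≡⟨ ∑-cong xs (λ x → ∑-*ˡ vs (if p x then f x else 0) (λ v → if E v then ∏ v else 0)) ⟩
      ∑ xs (λ x → (if p x then f x else 0) * μ n E)
        ≡⟨ ∑-*ʳ xs _ _ ⟩
      μ₁ p * μ n E ∎
      where
      open ≡-Reasoning
      vs : List (Vec A n)
      vs = allVecs xs n
      g : Vec A (suc n) → ℕ
      g v = if E′ v then ∏ v else 0
      factor : ∀ x v → g (x ∷ v) ≡ (if p x then f x else 0) * (if E v then ∏ v else 0)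
      factor x v = trans (cong (λ b → if b then f x * ∏ v else 0) (E′≡ x v)) (if-∧-* (p x) (E v) (f x) (∏ v))

    μ-⊤ : ∀ n → μ n (λ _ → true) ≡ ∑ xs f ^ n
    μ-⊤ zero    = refl
    μ-⊤ (suc n) = trans (μ-∷ (λ _ → true) (λ _ → true) (λ _ → true) (λ _ _ → refl))
                        (cong (∑ xs f *_) (μ-⊤ n))

    μ-every : ∀ n (p : A → Bool) → μ n (every p) ≡ μ₁ p ^ n
    μ-every zero    p = refl
    μ-every (suc n) p = trans (μ-∷ p (every p) (every p) (λ _ _ → refl)) (cong (μ₁ p *_) (μ-every n p))

    μ-∁ : ∀ n (E : Vec A n → Bool) → μ n E + μ n (not ∘ E) ≡ μ n (λ _ → true)
    μ-∁ n E = trans (sym (∑-distrib-+ (allVecs xs n) _ _))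
                    (∑-cong (allVecs xs n) (λ v → if-not-+ (E v) (∏ v)))

    μ-∨ : ∀ n (E F : Vec A n → Bool) → μ n (λ v → E v ∨ F v) ≤ μ n E + μ n F
    μ-∨ n E F = ≤-trans (∑-mono-≤ (allVecs xs n) (λ v → if-∨-≤ (E v) (F v) (∏ v)))
                        (≤-reflexive (∑-distrib-+ (allVecs xs n) _ _))

    μ-any : ∀ n {I : Set} (is : List I) (E : I → Vec A n → Bool) →
            μ n (λ v → any (λ i → E i v) is) ≤ ∑ is (λ i → μ n (E i))
    μ-any n []       E = ≤-trans (∑-≤-length (allVecs xs n) (λ _ → ≤-refl))
                                 (≤-reflexive (*-zeroʳ (length (allVecs xs n))))
    μ-any n (i ∷ is) E = ≤-trans (μ-∨ n (E i) (λ v → any (λ j → E j v) is))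
                                 (+-monoʳ-≤ (μ n (E i)) (μ-any n is E))

  any-false : ∀ {A : Set} (p : A → Bool) {xs x} → any p xs ≡ false → x ∈ xs → p x ≡ false
  any-false p           h (here refl)  = ∨-conicalˡ _ _ h
  any-false p {y ∷ _} h (there x∈xs) = any-false p (∨-conicalʳ (p y) _ h) x∈xs

  every-false : ∀ {A : Set} {t} (p : A → Bool) (ω : Vec A t) → every p ω ≡ false →
                Σ (Fin t) λ j → p (lookup ω j) ≡ false
  every-false p (x ∷ ω) h with p x in px
  ... | false = zero , px
  ... | true  = let (j , pj) = every-false p ω h in suc j , pj

  *-∑-allFin-≤ : ∀ {n} c (f : Fin n → ℕ) {a} → (∀ x → c * f x ≤ a) → c * ∑ (allFin n) f ≤ n * a
  *-∑-allFin-≤ {n} c f {a} cf≤a = begin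
    c * ∑ (allFin n) f              ≡⟨ ∑-*ˡ (allFin n) c f ⟨
    ∑ (allFin n) (λ x → c * f x)    ≤⟨ ∑-≤-length (allFin n) cf≤a ⟩
    length (allFin n) * a           ≡⟨ cong (_* a) (length-tabulate {n = n} (λ x → x)) ⟩
    n * a                           ∎
    where open ≤-Reasoning

module Arithmetic where

  open import Data.Nat
  open import Data.Nat.Induction using (<-wellFounded)
  open import Data.Nat.Logarithm using (⌈log₂_⌉)
  open import Data.Nat.Logarithm.Core using (⌈log2⌉)
  open import Data.Nat.Properties
  open import Data.Nat.Tactic.RingSolver using (solve-∀)
  open import Function using (_∘_)
  open import Induction.WellFounded using (Acc; acc)
  open import Relation.Binary.PropositionalEquality

  -- Bernoulli's inequality (1 + g/b)^(1+r) ≥ 1 + (1+r) g/b, cleared of denominators.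
  b^r*[b+[1+r]*g]≤[b+g]^[1+r] : ∀ b g r → b ^ r * (b + suc r * g) ≤ (b + g) ^ suc r
  b^r*[b+[1+r]*g]≤[b+g]^[1+r] b g zero = ≤-reflexive (e b g)
    where
    e : ∀ b g → 1 * (b + 1 * g) ≡ (b + g) * 1
    e = solve-∀
  b^r*[b+[1+r]*g]≤[b+g]^[1+r] b g (suc r) = begin
    b * b ^ r * (b + suc (suc r) * g)     ≡⟨ e₁ b (b ^ r) g r ⟩
    b ^ r * (b * (b + suc (suc r) * g))   ≤⟨ *-monoʳ-≤ (b ^ r) (m≤m+n _ (suc r * g * g)) ⟩
    b ^ r * (b * (b + suc (suc r) * g) + suc r * g * g)  ≡⟨ e₂ b (b ^ r) g r ⟩
    (b + g) * (b ^ r * (b + suc r * g))   ≤⟨ *-monoʳ-≤ (b + g) (b^r*[b+[1+r]*g]≤[b+g]^[1+r] b g r) ⟩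
    (b + g) * (b + g) ^ suc r             ∎
    where
    open ≤-Reasoning
    e₁ : ∀ b x g r → b * x * (b + suc (suc r) * g) ≡ x * (b * (b + suc (suc r) * g))
    e₁ = solve-∀
    e₂ : ∀ b x g r → x * (b * (b + suc (suc r) * g) + suc r * g * g) ≡ (b + g) * (x * (b + suc r * g))
    e₂ = solve-∀

  -- (1 - p)^m ≤ 1/2 once m p ≥ 1, for p = g/(b+g).
  2*b^m≤[b+g]^m : ∀ b g m → b + g ≤ m * g → 0 < b + g → 2 * b ^ m ≤ (b + g) ^ m
  2*b^m≤[b+g]^m b g m b+g≤m*g 0<b+g = *-cancelˡ-≤ (b + g) {{>-nonZero 0<b+g}} (begin
    (b + g) * (2 * b ^ m)      ≡⟨ e₁ b g (b ^ m) ⟩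
    b ^ m * (b + g + (b + g))  ≤⟨ *-monoʳ-≤ (b ^ m) (+-monoʳ-≤ (b + g) b+g≤m*g) ⟩
    b ^ m * (b + g + m * g)    ≡⟨ cong (b ^ m *_) (e₂ b g m) ⟩
    b ^ m * (b + suc m * g)    ≤⟨ b^r*[b+[1+r]*g]≤[b+g]^[1+r] b g m ⟩
    (b + g) * (b + g) ^ m      ∎)
    where
    open ≤-Reasoning
    e₁ : ∀ b g x → (b + g) * (2 * x) ≡ x * (b + g + (b + g))
    e₁ = solve-∀
    e₂ : ∀ b g m → b + g + m * g ≡ b + suc m * g
    e₂ = solve-∀

  2^s*a^s≤b^s : ∀ {a b} s → 2 * a ≤ b → 2 ^ s * a ^ s ≤ b ^ s
  2^s*a^s≤b^s zero    2a≤b = ≤-refl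
  2^s*a^s≤b^s {a} {b} (suc s) 2a≤b = begin
    2 * 2 ^ s * (a * a ^ s)    ≡⟨ [m*n]*[o*p]≡[m*o]*[n*p] 2 (2 ^ s) a (a ^ s) ⟩
    2 * a * (2 ^ s * a ^ s)    ≤⟨ *-mono-≤ 2a≤b (2^s*a^s≤b^s s 2a≤b) ⟩
    b * b ^ s                  ∎
    where open ≤-Reasoning

  -- Bernoulli's inequality (1 - 1/(1+k))^a ≥ 1 - a/(1+k), cleared of denominators (b = 1 + k - a).
  [1+k]^a*b≤k^a*[1+k] : ∀ k a b → a + b ≡ suc k → suc k ^ a * b ≤ k ^ a * suc k
  [1+k]^a*b≤k^a*[1+k] k zero    b refl = ≤-refl
  [1+k]^a*b≤k^a*[1+k] k (suc a) b a+b≡ = begin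
    suc k * suc k ^ a * b        ≡⟨ e₁ k (suc k ^ a) b ⟩
    suc k ^ a * (k * b + b)      ≤⟨ *-monoʳ-≤ (suc k ^ a) (+-monoʳ-≤ (k * b) b≤k) ⟩
    suc k ^ a * (k * b + k)      ≡⟨ e₂ k (suc k ^ a) b ⟩
    k * (suc k ^ a * suc b)      ≤⟨ *-monoʳ-≤ k ([1+k]^a*b≤k^a*[1+k] k a (suc b) (trans (+-suc a b) a+b≡)) ⟩
    k * (k ^ a * suc k)          ≡⟨ *-assoc k (k ^ a) (suc k) ⟨
    k * k ^ a * suc k            ∎
    where
    open ≤-Reasoning
    b≤k : b ≤ k
    b≤k = m+n≤o⇒n≤o a (≤-reflexive (suc-injective a+b≡))
    e₁ : ∀ k x b → suc k * x * b ≡ x * (k * b + b)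
    e₁ = solve-∀
    e₂ : ∀ k x b → x * (k * b + k) ≡ k * (x * suc b)
    e₂ = solve-∀

  [1+k]^a≤2*k^a : ∀ k a → 2 * a ≤ suc k → suc k ^ a ≤ 2 * k ^ a
  [1+k]^a≤2*k^a k a 2a≤1+k = *-cancelʳ-≤ (suc k ^ a) (2 * k ^ a) (suc k) (begin
    suc k ^ a * suc k      ≤⟨ *-monoʳ-≤ (suc k ^ a) 1+k≤2*b ⟩
    suc k ^ a * (2 * b)    ≡⟨ e (suc k ^ a) b ⟩
    2 * (suc k ^ a * b)    ≤⟨ *-monoʳ-≤ 2 ([1+k]^a*b≤k^a*[1+k] k a b a+b≡1+k) ⟩
    2 * (k ^ a * suc k)    ≡⟨ *-assoc 2 (k ^ a) (suc k) ⟨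
    2 * k ^ a * suc k      ∎)
    where
    open ≤-Reasoning
    b : ℕ
    b = suc k ∸ a
    a+b≡1+k : a + b ≡ suc k
    a+b≡1+k = m+[n∸m]≡n (≤-trans (m≤m+n a (a + 0)) 2a≤1+k)
    a≤b : a ≤ b
    a≤b = +-cancelˡ-≤ a a b (≤-trans (≤-reflexive (cong (a +_) (sym (+-identityʳ a)))) (≤-trans 2a≤1+k (≤-reflexive (sym a+b≡1+k))))
    1+k≤2*b : suc k ≤ 2 * b
    1+k≤2*b = ≤-trans (≤-reflexive (sym a+b≡1+k)) (+-mono-≤ a≤b (m≤m+n b 0))
    e : ∀ x b → x * (2 * b) ≡ 2 * (x * b)
    e = solve-∀

  2*⌊n/2⌋≤n : ∀ n → 2 * ⌊ n /2⌋ ≤ n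
  2*⌊n/2⌋≤n zero          = z≤n
  2*⌊n/2⌋≤n (suc zero)    = z≤n
  2*⌊n/2⌋≤n (suc (suc n)) = s≤s (≤-trans (≤-reflexive (+-suc ⌊ n /2⌋ (⌊ n /2⌋ + 0))) (s≤s (2*⌊n/2⌋≤n n)))

  -- Split s into halves, each small enough for the previous lemma.
  [1+k]^s≤4*k^s : ∀ k s → s ≤ k → suc k ^ s ≤ 4 * k ^ s
  [1+k]^s≤4*k^s k s s≤k = begin
    suc k ^ s                               ≡⟨ cong (suc k ^_) (⌊n/2⌋+⌈n/2⌉≡n s) ⟨
    suc k ^ (⌊ s /2⌋ + ⌈ s /2⌉)             ≡⟨ ^-distribˡ-+-* (suc k) ⌊ s /2⌋ ⌈ s /2⌉ ⟩
    suc k ^ ⌊ s /2⌋ * suc k ^ ⌈ s /2⌉       ≤⟨ *-mono-≤ ([1+k]^a≤2*k^a k ⌊ s /2⌋ half≤) ([1+k]^a≤2*k^a k ⌈ s /2⌉ half′≤) ⟩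
    2 * k ^ ⌊ s /2⌋ * (2 * k ^ ⌈ s /2⌉)     ≡⟨ [m*n]*[o*p]≡[m*o]*[n*p] 2 (k ^ ⌊ s /2⌋) 2 (k ^ ⌈ s /2⌉) ⟩
    4 * (k ^ ⌊ s /2⌋ * k ^ ⌈ s /2⌉)         ≡⟨ cong (4 *_) (^-distribˡ-+-* k ⌊ s /2⌋ ⌈ s /2⌉) ⟨
    4 * k ^ (⌊ s /2⌋ + ⌈ s /2⌉)             ≡⟨ cong (λ e → 4 * k ^ e) (⌊n/2⌋+⌈n/2⌉≡n s) ⟩
    4 * k ^ s                               ∎
    where
    open ≤-Reasoning
    half≤ : 2 * ⌊ s /2⌋ ≤ suc k
    half≤ = ≤-trans (2*⌊n/2⌋≤n s) (m≤n⇒m≤1+n s≤k)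
    half′≤ : 2 * ⌈ s /2⌉ ≤ suc k
    half′≤ = ≤-trans (2*⌊n/2⌋≤n (suc s)) (s≤s s≤k)

  n≤2^⌈log₂n⌉ : ∀ n → n ≤ 2 ^ ⌈log₂ n ⌉
  n≤2^⌈log₂n⌉ n = go n (<-wellFounded n)
    where
    go : ∀ n (rec : Acc _<_ n) → n ≤ 2 ^ ⌈log2⌉ n rec
    go zero          _         = z≤n
    go (suc zero)    _         = s≤s z≤n
    go (suc (suc n)) (acc rec) = begin
      suc (suc n)                      ≡⟨ cong (suc ∘ suc) (⌊n/2⌋+⌈n/2⌉≡n n) ⟨
      suc (suc (⌊ n /2⌋ + ⌈ n /2⌉))    ≤⟨ s≤s (s≤s (+-monoˡ-≤ ⌈ n /2⌉ (⌊n/2⌋≤⌈n/2⌉ n))) ⟩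
      suc (suc (⌈ n /2⌉ + ⌈ n /2⌉))    ≡⟨ e ⌈ n /2⌉ ⟩
      2 * suc ⌈ n /2⌉                  ≤⟨ *-monoʳ-≤ 2 (go (suc ⌈ n /2⌉) _) ⟩
      2 * 2 ^ ⌈log2⌉ (suc ⌈ n /2⌉) _   ∎
      where
      open ≤-Reasoning
      e : ∀ x → suc (suc (x + x)) ≡ 2 * suc x
      e = solve-∀

  n³≤2^[3*[1+⌈log₂n⌉]] : ∀ n → n * (n * n) ≤ 2 ^ (3 * suc ⌈log₂ n ⌉)
  n³≤2^[3*[1+⌈log₂n⌉]] n = begin
    n * (n * n)                 ≤⟨ *-mono-≤ n≤2^l (*-mono-≤ n≤2^l n≤2^l) ⟩
    2 ^ l * (2 ^ l * 2 ^ l)     ≡⟨ cong (2 ^ l *_) (^-distribˡ-+-* 2 l l) ⟨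
    2 ^ l * 2 ^ (l + l)         ≡⟨ ^-distribˡ-+-* 2 l (l + l) ⟨
    2 ^ (l + (l + l))           ≤⟨ ^-monoʳ-≤ 2 (≤-trans (m≤m+n (l + (l + l)) 3) (≤-reflexive (e l))) ⟩
    2 ^ (3 * suc l)             ∎
    where
    open ≤-Reasoning
    l : ℕ
    l = ⌈log₂ n ⌉
    n≤2^l : n ≤ 2 ^ l
    n≤2^l = n≤2^⌈log₂n⌉ n
    e : ∀ l → l + (l + l) + 3 ≡ 3 * suc l
    e = solve-∀

module Walks where

  open import Data.Empty using (⊥-elim)
  open import Data.Fin using (zero; suc; inject₁; fromℕ)
  open import Data.Fin.Subset using (Subset; _∈_)
  open import Data.Nat using (ℕ)
  open import Data.Product using (Σ; _×_; _,_)
  open import Data.Sum using (inj₁; inj₂; swap)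
  open import Data.Vec using (Vec; []; _∷_; lookup)
  open import Data.Vec.Relation.Unary.All as All using (decide)
  open import Data.Vec.Relation.Unary.Any using (Any; here; there)
  open import Data.Vec.Relation.Unary.Unique.Propositional using (Unique; []; _∷_)
  open import Function using (_∘′_)
  open import Relation.Binary.Construct.Closure.ReflexiveTransitive using (Star; ε; _◅_)
  open import Relation.Binary.Definitions using (DecidableEquality)
  open import Relation.Binary.PropositionalEquality
  open import Relation.Nullary using (¬_; yes; no)
  open import Relation.Nullary.Decidable using (toSum)
  open import Relation.Unary using (Decidable)
  open import Defs

  _↾_ : {A : Set} → (A → A → Set) → (A → Set) → A → A → Set
  (R ↾ P) x y = P x × R x y × P y

  module _ {n : ℕ} {G : Graph n} {S : Subset n} where

    ConnIn-head : ∀ {x y} → ConnIn G S x y → x ∈ S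
    ConnIn-head (here x∈S)     = x∈S
    ConnIn-head (step x∈S _ _) = x∈S

    ConnIn⇒Star : ∀ {x y} → ConnIn G S x y → Star (G ↾ (_∈ S)) x y
    ConnIn⇒Star (here _)          = ε
    ConnIn⇒Star (step x∈S Gxw c) = (x∈S , Gxw , ConnIn-head c) ◅ ConnIn⇒Star c

  module _ {A : Set} {R : A → A → Set} {P : A → Set} where

    first-entry : Decidable P → ∀ {a b} → Star R a b → ¬ P a → P b →
                  Σ A λ p → Σ A λ q → Star (R ↾ (¬_ ∘′ P)) a p × ¬ P p × R p q × P q
    first-entry P? ε                   ¬Pa Pb = ⊥-elim (¬Pa Pb)
    first-entry P? (_◅_ {j = w} r rs) ¬Pa Pb with P? w
    ... | yes Pw  = _ , w , ε , ¬Pa , r , Pw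
    ... | no  ¬Pw with first-entry P? rs ¬Pw Pb
    ...   | p , q , rs′ , ¬Pp , Rpq , Pq = p , q , (¬Pa , r , ¬Pw) ◅ rs′ , ¬Pp , Rpq , Pq

  data WalkVia {A : Set} (R : A → A → Set) : A → A → ∀ {l} → Vec A l → Set where
    []  : ∀ {x} → WalkVia R x x []
    _∷_ : ∀ {x w y l} {vs : Vec A l} → R x w → WalkVia R w y vs → WalkVia R x y (w ∷ vs)

  module _ {A : Set} {R : A → A → Set} where

    SimpleWalk : A → A → Set
    SimpleWalk x y = Σ ℕ λ l → Σ (Vec A l) λ vs → WalkVia R x y vs × Unique (x ∷ vs)

    WalkVia-edge : ∀ {x y l} {vs : Vec A l} → WalkVia R x y vs →
                   ∀ i → R (lookup (x ∷ vs) (inject₁ i)) (lookup (x ∷ vs) (suc i))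
    WalkVia-edge (r ∷ _)  zero    = r
    WalkVia-edge (_ ∷ rs) (suc i) = WalkVia-edge rs i

    WalkVia-end : ∀ {x y l} {vs : Vec A l} → WalkVia R x y vs → lookup (x ∷ vs) (fromℕ l) ≡ y
    WalkVia-end []       = refl
    WalkVia-end (_ ∷ rs) = WalkVia-end rs

    private
      suffix : ∀ {x w y l} {vs : Vec A l} → Any (x ≡_) (w ∷ vs) → WalkVia R w y vs → Unique (w ∷ vs) →
               SimpleWalk x y
      suffix (here refl) rs       u       = _ , _ , rs , u
      suffix (there x∈)  (_ ∷ rs) (_ ∷ u) = suffix x∈ rs u

    loop-erase : DecidableEquality A → ∀ {x y} → Star R x y → SimpleWalk x y
    loop-erase _≟_ ε = _ , [] , [] , All.[] ∷ []
    loop-erase _≟_ {x} (_◅_ {j = w} r rs) with loop-erase _≟_ rs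
    ... | _ , vs , walk , u with decide (λ v → swap (toSum (x ≟ v))) (w ∷ vs)
    ...   | inj₁ x∉ = _ , w ∷ vs , r ∷ walk , x∉ ∷ u
    ...   | inj₂ x∈ = suffix x∈ walk u

module TreeDecompositions where

  open import Data.Empty using (⊥; ⊥-elim)
  open import Data.Fin using (Fin; suc; inject₁; fromℕ)
  open import Data.Fin.Properties using (_≟_; any?)
  open import Data.Fin.Subset using (_∈_; _∉_)
  open import Data.Fin.Subset.Properties using (_∈?_)
  open import Data.Nat using (ℕ; suc; _+_)
  open import Data.Product using (Σ; _×_; _,_; proj₁; proj₂)
  open import Data.Product.Properties using (≡-dec)
  open import Data.Sum using (_⊎_; inj₁; inj₂)
  open import Data.Vec using ([]; _∷_; lookup)
  open import Data.Vec.Relation.Unary.Unique.Propositional.Properties using (lookup-injective)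
  open import Relation.Binary.Construct.Closure.ReflexiveTransitive using (Star; ε; _◅_; _◅◅_)
  import Relation.Binary.Construct.Closure.ReflexiveTransitive as Star
  open import Relation.Binary.PropositionalEquality
  open import Relation.Nullary using (¬_; Dec; yes; no)
  open import Relation.Nullary.Decidable using (_×-dec_)
  open import Defs
  open Walks

  module TreeEdge {N : ℕ} (T : Graph N) (tree : IsTree T) {i j : Fin N} (Tij : T i j) where

    private
      symmetric : Symmetric T
      symmetric = proj₁ tree
      irreflexive : Irreflexive T
      irreflexive = proj₁ (proj₂ tree)
      acyclic : ¬ Cycle T
      acyclic = proj₂ (proj₂ (proj₂ tree))

    T∖ij : Graph N
    T∖ij a b = T a b × (a , b) ≢ (i , j) × (a , b) ≢ (j , i)

    Side : Fin N → Set
    Side = Star T∖ij i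

    j∉Side : ¬ Side j
    j∉Side side with loop-erase _≟_ side
    ... | 0 , [] , [] , _ = irreflexive i Tij
    ... | 1 , _ ∷ [] , (_ , i,j≢i,j , _) ∷ [] , _ = i,j≢i,j refl
    ... | suc (suc l) , vs , walk , unique = acyclic (l , lookup (i ∷ vs) , injective , edges , closing)
      where
      injective : ∀ {a b} → lookup (i ∷ vs) a ≡ lookup (i ∷ vs) b → a ≡ b
      injective = lookup-injective unique _ _
      edges : ∀ a → T (lookup (i ∷ vs) (inject₁ a)) (lookup (i ∷ vs) (suc a))
      edges a = proj₁ (WalkVia-edge walk a)
      closing : T (lookup (i ∷ vs) (fromℕ (2 + l))) i
      closing = subst (λ v → T v i) (sym (WalkVia-end walk)) (symmetric i j Tij)

    cross-or-stay : ∀ {P : Fin N → Set} {a c} → Star (T ↾ P) a c → Side a → (P i × P j) ⊎ Side c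
    cross-or-stay ε side = inj₂ side
    cross-or-stay (_◅_ {i = a} {j = b} (Pa , Tab , Pb) rs) side
      with ≡-dec _≟_ _≟_ (a , b) (i , j) | ≡-dec _≟_ _≟_ (a , b) (j , i)
    ... | yes refl | _        = inj₁ (Pa , Pb)
    ... | no _     | yes refl = inj₁ (Pb , Pa)
    ... | no a,b≢i,j | no a,b≢j,i = cross-or-stay rs (side ◅◅ (Tab , a,b≢i,j , a,b≢j,i) ◅ ε)

  module Separation {n : ℕ} {G : Graph n} (D : TreeDecomposition G) where

    open TreeDecomposition D

    private
      symmetric : Symmetric T
      symmetric = proj₁ isTree
      connected : Connected T
      connected = proj₁ (proj₂ (proj₂ isTree))

    Node : Set
    Node = Fin (suc m)

    Share : Fin n → Fin n → Set
    Share u v = Σ Node λ a → u ∈ bag a × v ∈ bag a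

    share? : ∀ u v → Dec (Share u v)
    share? u v = any? (λ a → u ∈? bag a ×-dec v ∈? bag a)

    Separates : Fin n → Fin n → Node → Set
    Separates u v i = v ∉ bag i × (∀ Q → (∀ z → z ∈ Q → z ∈ bag i → z ≡ u) → ¬ ConnIn G Q u v)

    bags-walk : ∀ {x a c} → x ∈ bag a → x ∈ bag c → Star (T ↾ (λ d → x ∈ bag d)) a c
    bags-walk {x} {a} {c} x∈a x∈c with subtree x a c x∈a x∈c
    ... | B , B⊆ , walk = Star.map (λ (b∈B , Tbd , d∈B) → B⊆ _ b∈B , Tbd , B⊆ _ d∈B) (ConnIn⇒Star walk)

    module _ {i j : Node} (Tij : T i j) where

      open TreeEdge T isTree Tij

      -- Consecutive vertices of the walk share a bag, and the bags of one vertex form a subtree,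
      -- which can only leave i's side through bag i ∩ bag j.
      stays-on-side : ∀ {Q x y} → (∀ z → z ∈ Q → z ∈ bag i → z ∈ bag j → ⊥) → ConnIn G Q x y →
                      ∀ {a} → x ∈ bag a → Side a → Σ Node λ c → y ∈ bag c × Side c
      stays-on-side avoid (here _) x∈a side = _ , x∈a , side
      stays-on-side avoid (step {u = x} {w = w} x∈Q Gxw walk) x∈a side with edges x w Gxw
      ... | c , x∈c , w∈c with cross-or-stay (bags-walk x∈a x∈c) side
      ...   | inj₁ (x∈i , x∈j) = ⊥-elim (avoid x x∈Q x∈i x∈j)
      ...   | inj₂ side-c      = stays-on-side avoid walk w∈c side-c

    -- ij is the edge through which a tree path from a bag b of v enters the subtree of bags of u.
    separate : ∀ {u v} → ¬ Share u v → Σ Node λ i → u ∈ bag i × Separates u v i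
    separate {u} {v} ¬share with covers u | covers v
    ... | a , u∈a | b , v∈b
      with first-entry (λ d → u ∈? bag d) (Star.map (λ (_ , r , _) → r) (ConnIn⇒Star (connected b a)))
                       (λ u∈b → ¬share (b , u∈b , v∈b)) u∈a
    ... | j , i , b→j , u∉j , Tji , u∈i = i , u∈i , v∉i , cut
      where
      Tij : T i j
      Tij = symmetric j i Tji
      open TreeEdge T isTree Tij
      v∉i : v ∉ bag i
      v∉i v∈i = ¬share (i , u∈i , v∈i)
      b∉Side : ¬ Side b
      b∉Side side = j∉Side (side ◅◅ Star.map avoid-i b→j)
        where
        avoid-i : ∀ {c d} → (T ↾ (λ e → u ∉ bag e)) c d → T∖ij c d
        avoid-i (u∉c , Tcd , u∉d) = Tcd , (λ { refl → u∉c u∈i }) , (λ { refl → u∉d u∈i })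
      Q∩i∩j=∅ : ∀ {Q} → (∀ z → z ∈ Q → z ∈ bag i → z ≡ u) → ∀ z → z ∈ Q → z ∈ bag i → z ∈ bag j → ⊥
      Q∩i∩j=∅ Q∩i⊆u z z∈Q z∈i z∈j = u∉j (subst (_∈ bag j) (Q∩i⊆u z z∈Q z∈i) z∈j)
      cut : ∀ Q → (∀ z → z ∈ Q → z ∈ bag i → z ≡ u) → ¬ ConnIn G Q u v
      cut Q Q∩i⊆u walk with stays-on-side Tij (Q∩i∩j=∅ Q∩i⊆u) walk u∈i ε
      ... | c , v∈c , side with cross-or-stay (bags-walk v∈c v∈b) side
      ...   | inj₁ (v∈i , _) = v∉i v∈i
      ...   | inj₂ side-b    = b∉Side side-b

module Sampling where

  open import Data.Bool using (Bool; true; false; not; _∧_)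
  open import Data.Bool.Properties using (∧-conicalʳ)
  open import Data.Fin.Subset using (Subset; _∈_; _⊆_; _∪_; ∣_∣)
  open import Data.Fin.Subset.Properties using (∣p∣≤∣x∷p∣)
  open import Data.List using (List; []; _∷_)
  open import Data.Nat
  open import Data.Nat.Properties
  open import Data.Nat.Tactic.RingSolver using (solve-∀)
  open import Data.Vec using ([]; _∷_; here; there)
  open import Relation.Binary.PropositionalEquality
  open import Defs using (allVecs)
  open Sums
  open Arithmetic

  bools : List Bool
  bools = true ∷ false ∷ []

  -- Probabilities are handled as integer weights: w k b is (k+1)·Pr[v ∈ Q] for b = true and
  -- (k+1)·Pr[v ∉ Q] for b = false, so Subsets.μ k n E is (k+1)ⁿ·Pr[Q ∈ E] for one query Q.
  w : ℕ → Bool → ℕ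
  w k true  = 1
  w k false = k

  module Subsets (k : ℕ) = ProductMeasure bools (w k)
  module Outcomes (k n : ℕ) = ProductMeasure (allVecs bools n) (Subsets.∏ k)

  Subsets-total : ∀ k n → Subsets.μ k n (λ _ → true) ≡ suc k ^ n
  Subsets-total k n = trans (Subsets.μ-⊤ k n) (cong (_^ n) (cong suc (+-identityʳ k)))

  Outcomes-total : ∀ k n t → Outcomes.μ k n t (λ _ → true) ≡ (suc k ^ n) ^ t
  Outcomes-total k n t = trans (Outcomes.μ-⊤ k n t) (cong (_^ t) (Subsets-total k n))

  ∣p∪q∣≤∣p∣+∣q∣ : ∀ {n} (p q : Subset n) → ∣ p ∪ q ∣ ≤ ∣ p ∣ + ∣ q ∣
  ∣p∪q∣≤∣p∣+∣q∣ []          []          = z≤n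
  ∣p∪q∣≤∣p∣+∣q∣ (true  ∷ p) (b     ∷ q) =
    s≤s (≤-trans (∣p∪q∣≤∣p∣+∣q∣ p q) (+-monoʳ-≤ ∣ p ∣ (∣p∣≤∣x∷p∣ b q)))
  ∣p∪q∣≤∣p∣+∣q∣ (false ∷ p) (true  ∷ q) =
    ≤-trans (s≤s (∣p∪q∣≤∣p∣+∣q∣ p q)) (≤-reflexive (sym (+-suc ∣ p ∣ ∣ q ∣)))
  ∣p∪q∣≤∣p∣+∣q∣ (false ∷ p) (false ∷ q) = ∣p∪q∣≤∣p∣+∣q∣ p q

  admits : Bool → Bool → Bool → Bool
  admits true  _     c = c
  admits false true  c = not c
  admits false false _ = true

  cylinder : ∀ {n} → Subset n → Subset n → Subset n → Bool
  cylinder []      []      []      = true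
  cylinder (i ∷ I) (o ∷ O) (c ∷ Q) = admits i o c ∧ cylinder I O Q

  cylinder-⊇ : ∀ {n} {I O Q : Subset n} → cylinder I O Q ≡ true → I ⊆ Q
  cylinder-⊇ {I = true ∷ _} {_ ∷ _} {true ∷ _} _ here = here
  cylinder-⊇ {I = i ∷ _} {o ∷ _} {c ∷ _} h (there x∈I) =
    there (cylinder-⊇ (∧-conicalʳ (admits i o c) _ h) x∈I)

  cylinder-∩ : ∀ {n} {I O Q : Subset n} {x} → cylinder I O Q ≡ true → x ∈ O → x ∈ Q → x ∈ I
  cylinder-∩ {I = true ∷ _}  {true ∷ _} {true ∷ _} _  here here = here
  cylinder-∩ {I = false ∷ _} {true ∷ _} {true ∷ _} () here here
  cylinder-∩ {I = i ∷ _} {o ∷ _} {c ∷ _} h (there x∈O) (there x∈Q) =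
    there (cylinder-∩ (∧-conicalʳ (admits i o c) _ h) x∈O x∈Q)

  module _ (k : ℕ) where

    open Subsets k

    -- Pr[cylinder I O] ≥ (k+1)^-∣I∣ · (k/(k+1))^∣O∣.
    μ-cylinder : ∀ {n} (I O : Subset n) →
                 k ^ ∣ O ∣ * suc k ^ n ≤ μ n (cylinder I O) * suc k ^ ∣ I ∣ * suc k ^ ∣ O ∣
    μ-cylinder []      []      = ≤-refl
    μ-cylinder {suc n} (i ∷ I) (o ∷ O) =
      subst (λ μ′ → k ^ ∣ o ∷ O ∣ * suc k ^ suc n ≤ μ′ * suc k ^ ∣ i ∷ I ∣ * suc k ^ ∣ o ∷ O ∣)
            (sym (μ-∷ (admits i o) (cylinder I O) (cylinder (i ∷ I) (o ∷ O)) (λ _ _ → refl)))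
            (vertex i o (μ-cylinder I O))
      where
      K N X A B : ℕ
      K = k ^ ∣ O ∣
      N = suc k ^ n
      X = μ n (cylinder I O)
      A = suc k ^ ∣ I ∣
      B = suc k ^ ∣ O ∣
      e₀ : ∀ K s N → K * (s * N) ≡ s * (K * N)
      e₀ = solve-∀
      e₁ : ∀ k K s N → k * K * (s * N) ≡ k * s * (K * N)
      e₁ = solve-∀
      vertex : ∀ i o → K * N ≤ X * A * B →
               k ^ ∣ o ∷ O ∣ * (suc k * N) ≤ μ₁ (admits i o) * X * suc k ^ ∣ i ∷ I ∣ * suc k ^ ∣ o ∷ O ∣
      vertex true  true  ih = ≤-trans (≤-reflexive (e₁ k K (suc k) N))
        (≤-trans (*-mono-≤ (*-monoˡ-≤ (suc k) (n≤1+n k)) ih) (≤-reflexive (e₂ (suc k) X A B)))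
        where
        e₂ : ∀ s X A B → s * s * (X * A * B) ≡ 1 * X * (s * A) * (s * B)
        e₂ = solve-∀
      vertex true  false ih = ≤-trans (≤-reflexive (e₀ K (suc k) N))
        (≤-trans (*-monoʳ-≤ (suc k) ih) (≤-reflexive (e₂ (suc k) X A B)))
        where
        e₂ : ∀ s X A B → s * (X * A * B) ≡ 1 * X * (s * A) * B
        e₂ = solve-∀
      vertex false true  ih = ≤-trans (≤-reflexive (e₁ k K (suc k) N))
        (≤-trans (*-monoʳ-≤ (k * suc k) ih) (≤-reflexive (e₂ k (suc k) X A B)))
        where
        e₂ : ∀ k s X A B → k * s * (X * A * B) ≡ (0 + (k + 0)) * X * A * (s * B)
        e₂ = solve-∀
      vertex false false ih = ≤-trans (≤-reflexive (e₀ K (suc k) N))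
        (≤-trans (*-monoʳ-≤ (suc k) ih) (≤-reflexive (e₂ k X A B)))
        where
        e₂ : ∀ k X A B → suc k * (X * A * B) ≡ (1 + (k + 0)) * X * A * B
        e₂ = solve-∀

    μ-cylinder-≥ : ∀ {n} (I O : Subset n) → ∣ I ∣ ≤ 2 → ∣ O ∣ ≤ k →
                   suc k ^ n ≤ 4 * suc k ^ 2 * μ n (cylinder I O)
    μ-cylinder-≥ {n} I O ∣I∣≤2 ∣O∣≤k = *-cancelʳ-≤ (suc k ^ n) _ B {{m^n≢0 (suc k) ∣ O ∣}} (begin
      suc k ^ n * B                ≤⟨ *-monoʳ-≤ (suc k ^ n) ([1+k]^s≤4*k^s k ∣ O ∣ ∣O∣≤k) ⟩
      suc k ^ n * (4 * k ^ ∣ O ∣)  ≡⟨ e₁ (suc k ^ n) (k ^ ∣ O ∣) ⟩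
      4 * (k ^ ∣ O ∣ * suc k ^ n)  ≤⟨ *-monoʳ-≤ 4 (μ-cylinder I O) ⟩
      4 * (X * suc k ^ ∣ I ∣ * B)  ≤⟨ *-monoʳ-≤ 4 (*-monoˡ-≤ B (*-monoʳ-≤ X (^-monoʳ-≤ (suc k) ∣I∣≤2))) ⟩
      4 * (X * suc k ^ 2 * B)      ≡⟨ e₂ X (suc k ^ 2) B ⟩
      4 * suc k ^ 2 * X * B        ∎)
      where
      open ≤-Reasoning
      X B : ℕ
      X = μ n (cylinder I O)
      B = suc k ^ ∣ O ∣
      e₁ : ∀ N K → N * (4 * K) ≡ 4 * (K * N)
      e₁ = solve-∀
      e₂ : ∀ X S B → 4 * (X * S * B) ≡ 4 * S * X * B
      e₂ = solve-∀

module Rationals where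

  open import Algebra.Bundles using (CommutativeMonoid)
  open import Data.Bool using (true; false; if_then_else_)
  open import Data.Empty using (⊥-elim)
  open import Data.Fin.Subset using (Subset)
  open import Data.Integer as ℤ using (+_; +[1+_]; -[1+_])
  import Data.Integer.Properties as ℤ
  open import Data.List using ([]; _∷_)
  open import Data.Nat as ℕ using (ℕ; suc)
  import Data.Nat.Properties as ℕ
  open import Data.Product using (Σ; _,_)
  open import Data.Rational
  open import Data.Rational.Properties
  import Data.Rational.Unnormalised as ℚᵘ
  import Data.Rational.Unnormalised.Properties as ℚᵘ
  open import Data.Vec using (Vec; []; _∷_)
  open import Relation.Binary.PropositionalEquality
  open import Algebra.Properties.CommutativeSemigroup
    (CommutativeMonoid.commutativeSemigroup *-1-commutativeMonoid)
    using (x∙yz≈y∙xz) renaming (interchange to *-interchange)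
  open import Defs using (allVecs; subsetWeight; outcomeWeight; sumWeights; Prob)
  open Sums using (∑)
  open Sampling using (bools; module Subsets; module Outcomes)

  ι : ℕ → ℚ
  ι a = + a / 1

  private
    toℚᵘ-ι : ∀ a → toℚᵘ (ι a) ℚᵘ.≃ ℚᵘ.mkℚᵘ (+ a) 0
    toℚᵘ-ι a = toℚᵘ-fromℚᵘ (ℚᵘ.mkℚᵘ (+ a) 0)

  ι-+ : ∀ a b → ι (a ℕ.+ b) ≡ ι a + ι b
  ι-+ a b = toℚᵘ-injective (begin
    toℚᵘ (ι (a ℕ.+ b))                             ≈⟨ toℚᵘ-ι (a ℕ.+ b) ⟩
    ℚᵘ.mkℚᵘ (+ (a ℕ.+ b)) 0                        ≈⟨ ℚᵘ.*≡* cross ⟩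
    ℚᵘ.mkℚᵘ (+ a) 0 ℚᵘ.+ ℚᵘ.mkℚᵘ (+ b) 0           ≈⟨ ℚᵘ.+-cong (toℚᵘ-ι a) (toℚᵘ-ι b) ⟨
    toℚᵘ (ι a) ℚᵘ.+ toℚᵘ (ι b)                     ≈⟨ toℚᵘ-homo-+ (ι a) (ι b) ⟨
    toℚᵘ (ι a + ι b)                               ∎)
    where
    open ℚᵘ.≃-Reasoning
    cross : + (a ℕ.+ b) ℤ.* + 1 ≡ (+ a ℤ.* + 1 ℤ.+ + b ℤ.* + 1) ℤ.* + 1
    cross = cong (ℤ._* + 1) (trans (ℤ.pos-+ a b) (sym (cong₂ ℤ._+_ (ℤ.*-identityʳ (+ a)) (ℤ.*-identityʳ (+ b)))))

  ι-* : ∀ a b → ι (a ℕ.* b) ≡ ι a * ι b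
  ι-* a b = toℚᵘ-injective (begin
    toℚᵘ (ι (a ℕ.* b))                             ≈⟨ toℚᵘ-ι (a ℕ.* b) ⟩
    ℚᵘ.mkℚᵘ (+ (a ℕ.* b)) 0                        ≈⟨ ℚᵘ.*≡* (cong (ℤ._* + 1) (ℤ.pos-* a b)) ⟩
    ℚᵘ.mkℚᵘ (+ a) 0 ℚᵘ.* ℚᵘ.mkℚᵘ (+ b) 0           ≈⟨ ℚᵘ.*-cong (toℚᵘ-ι a) (toℚᵘ-ι b) ⟨
    toℚᵘ (ι a) ℚᵘ.* toℚᵘ (ι b)                     ≈⟨ toℚᵘ-homo-* (ι a) (ι b) ⟨
    toℚᵘ (ι a * ι b)                               ∎)
    where open ℚᵘ.≃-Reasoning

  ι-mono-≤ : ∀ {a b} → a ℕ.≤ b → ι a ≤ ι b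
  ι-mono-≤ {a} {b} a≤b = toℚᵘ-cancel-≤ (begin
    toℚᵘ (ι a)        ≃⟨ toℚᵘ-ι a ⟩
    ℚᵘ.mkℚᵘ (+ a) 0   ≤⟨ ℚᵘ.*≤* (ℤ.*-monoʳ-≤-nonNeg (+ 1) (ℤ.+≤+ a≤b)) ⟩
    ℚᵘ.mkℚᵘ (+ b) 0   ≃⟨ toℚᵘ-ι b ⟨
    toℚᵘ (ι b)        ∎)
    where open ℚᵘ.≤-Reasoning

  ι-mono-< : ∀ {a b} → a ℕ.< b → ι a < ι b
  ι-mono-< {a} {b} a<b = toℚᵘ-cancel-< (begin-strict
    toℚᵘ (ι a)        ≃⟨ toℚᵘ-ι a ⟩
    ℚᵘ.mkℚᵘ (+ a) 0   <⟨ ℚᵘ.*<* (ℤ.*-monoʳ-<-pos (+ 1) (ℤ.+<+ a<b)) ⟩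
    ℚᵘ.mkℚᵘ (+ b) 0   ≃⟨ toℚᵘ-ι b ⟨
    toℚᵘ (ι b)        ∎)
    where open ℚᵘ.≤-Reasoning

  a/[1+k]*[1+k]≡a : ∀ a k → (+ a / suc k) * ι (suc k) ≡ ι a
  a/[1+k]*[1+k]≡a a k = toℚᵘ-injective (begin
    toℚᵘ ((+ a / suc k) * ι (suc k))               ≈⟨ toℚᵘ-homo-* (+ a / suc k) (ι (suc k)) ⟩
    toℚᵘ (+ a / suc k) ℚᵘ.* toℚᵘ (ι (suc k))       ≈⟨ ℚᵘ.*-cong (toℚᵘ-fromℚᵘ (ℚᵘ.mkℚᵘ (+ a) k)) (toℚᵘ-ι (suc k)) ⟩
    ℚᵘ.mkℚᵘ (+ a) k ℚᵘ.* ℚᵘ.mkℚᵘ (+ suc k) 0       ≈⟨ ℚᵘ.*≡* cross ⟩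
    ℚᵘ.mkℚᵘ (+ a) 0                                ≈⟨ toℚᵘ-ι a ⟨
    toℚᵘ (ι a)                                     ∎)
    where
    open ℚᵘ.≃-Reasoning
    cross : (+ a ℤ.* + suc k) ℤ.* + 1 ≡ + a ℤ.* + suc (k ℕ.* 1)
    cross = trans (ℤ.*-identityʳ _) (cong (λ d → + a ℤ.* + suc d) (sym (ℕ.*-identityʳ k)))

  scale-* : ∀ x y d e b c → x * ι d ≡ ι b → y * ι e ≡ ι c → (x * y) * ι (d ℕ.* e) ≡ ι (b ℕ.* c)
  scale-* x y d e b c xd≡b ye≡c = begin
    (x * y) * ι (d ℕ.* e)      ≡⟨ cong ((x * y) *_) (ι-* d e) ⟩
    (x * y) * (ι d * ι e)      ≡⟨ *-interchange x y (ι d) (ι e) ⟩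
    (x * ι d) * (y * ι e)      ≡⟨ cong₂ _*_ xd≡b ye≡c ⟩
    ι b * ι c                  ≡⟨ ι-* b c ⟨
    ι (b ℕ.* c)                ∎
    where open ≡-Reasoning

  a≤c+b⇒a-b≤c : ∀ {a b c} → a ≤ c + b → a - b ≤ c
  a≤c+b⇒a-b≤c {a} {b} {c} a≤c+b = begin
    a - b            ≤⟨ +-monoˡ-≤ (- b) a≤c+b ⟩
    c + b - b        ≡⟨ +-assoc c b (- b) ⟩
    c + (b - b)      ≡⟨ cong (λ z → c + z) (+-inverseʳ b) ⟩
    c + 0ℚ           ≡⟨ +-identityʳ c ⟩
    c                ∎
    where open ≤-Reasoning

  -- p = W/T, where the complementary weight B is at most T/(1+M).
  1-1/[1+M]≤p : ∀ (p : ℚ) M {T W B} → p * ι T ≡ ι W → B ℕ.+ W ≡ T → suc M ℕ.* B ℕ.≤ T → 0 ℕ.< T →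
                1ℚ - + 1 / suc M ≤ p
  1-1/[1+M]≤p p M {T} {W} {B} pT≡W B+W≡T MB≤T 0<T = *-cancelʳ-≤-pos r (begin
    (1ℚ - x) * r            ≡⟨ *-distribʳ-+ r 1ℚ (- x) ⟩
    1ℚ * r + - x * r        ≡⟨ cong₂ _+_ (*-identityˡ r) (sym (neg-distribˡ-* x r)) ⟩
    r - x * r               ≡⟨ cong (λ z → r - z) xr≡T ⟩
    r - ι T                 ≤⟨ a≤c+b⇒a-b≤c (≤-trans (ι-mono-≤ MT≤MW+T) (≤-reflexive (ι-+ (suc M ℕ.* W) T))) ⟩
    ι (suc M ℕ.* W)         ≡⟨ ι-* (suc M) W ⟩
    ι (suc M) * ι W         ≡⟨ cong (ι (suc M) *_) pT≡W ⟨
    ι (suc M) * (p * ι T)   ≡⟨ x∙yz≈y∙xz (ι (suc M)) p (ι T) ⟩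
    p * (ι (suc M) * ι T)   ≡⟨ cong (p *_) (ι-* (suc M) T) ⟨
    p * r                   ∎)
    where
    open ≤-Reasoning
    x r : ℚ
    x = + 1 / suc M
    r = ι (suc M ℕ.* T)
    instance
      r-positive : Positive r
      r-positive = positive (ι-mono-< (ℕ.*-mono-≤ {1} {suc M} (ℕ.s≤s ℕ.z≤n) 0<T))
    xr≡T : x * r ≡ ι T
    xr≡T = begin-equality
      x * ι (suc M ℕ.* T)       ≡⟨ cong (x *_) (ι-* (suc M) T) ⟩
      x * (ι (suc M) * ι T)     ≡⟨ *-assoc x (ι (suc M)) (ι T) ⟨
      x * ι (suc M) * ι T       ≡⟨ cong (_* ι T) (a/[1+k]*[1+k]≡a 1 M) ⟩
      1ℚ * ι T                  ≡⟨ *-identityˡ (ι T) ⟩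
      ι T                       ∎
    MT≤MW+T : suc M ℕ.* T ℕ.≤ suc M ℕ.* W ℕ.+ T
    MT≤MW+T = ℕ.≤-trans (ℕ.≤-reflexive (trans (cong (suc M ℕ.*_) (sym (trans (ℕ.+-comm W B) B+W≡T)))
                                              (ℕ.*-distribˡ-+ (suc M) W B)))
                        (ℕ.+-monoʳ-≤ (suc M ℕ.* W) MB≤T)

  1/[1+M]≤ε : ∀ ε → 0ℚ < ε → Σ ℕ λ M → + 1 / suc M ≤ ε
  1/[1+M]≤ε (mkℚ (+ 0)      _ _) 0<ε = ⊥-elim (ℤ.Positive.pos (positive 0<ε))
  1/[1+M]≤ε (mkℚ +[1+ a ]   M _) _   = M , toℚᵘ-cancel-≤ (begin
    toℚᵘ (+ 1 / suc M)   ≃⟨ toℚᵘ-fromℚᵘ (ℚᵘ.mkℚᵘ (+ 1) M) ⟩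
    ℚᵘ.mkℚᵘ (+ 1) M      ≤⟨ ℚᵘ.*≤* (ℤ.*-monoʳ-≤-nonNeg (+ suc M) (ℤ.+≤+ (ℕ.s≤s (ℕ.z≤n {a})))) ⟩
    ℚᵘ.mkℚᵘ +[1+ a ] M   ∎)
    where open ℚᵘ.≤-Reasoning
  1/[1+M]≤ε (mkℚ -[1+ _ ]   _ _) 0<ε = ⊥-elim (ℤ.Positive.pos (positive 0<ε))

  subsetWeight-scaled : ∀ k {n} (Q : Subset n) → subsetWeight k Q * ι (suc k ℕ.^ n) ≡ ι (Subsets.∏ k Q)
  subsetWeight-scaled k []          = *-identityˡ (ι 1)
  subsetWeight-scaled k {suc n} (true  ∷ Q) =
    scale-* (+ 1 / suc k) (subsetWeight k Q) (suc k) (suc k ℕ.^ n) 1 (Subsets.∏ k Q)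
            (a/[1+k]*[1+k]≡a 1 k) (subsetWeight-scaled k Q)
  subsetWeight-scaled k {suc n} (false ∷ Q) =
    scale-* (+ k / suc k) (subsetWeight k Q) (suc k) (suc k ℕ.^ n) k (Subsets.∏ k Q)
            (a/[1+k]*[1+k]≡a k k) (subsetWeight-scaled k Q)

  outcomeWeight-scaled : ∀ k {n t} (ω : Vec (Subset n) t) →
                         outcomeWeight k ω * ι ((suc k ℕ.^ n) ℕ.^ t) ≡ ι (Outcomes.∏ k n ω)
  outcomeWeight-scaled k []      = *-identityˡ (ι 1)
  outcomeWeight-scaled k {n} {suc t} (Q ∷ ω) =
    scale-* (subsetWeight k Q) (outcomeWeight k ω) (suc k ℕ.^ n) ((suc k ℕ.^ n) ℕ.^ t)
            (Subsets.∏ k Q) (Outcomes.∏ k n ω) (subsetWeight-scaled k Q) (outcomeWeight-scaled k ω)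

  Prob-scaled : ∀ n k t E → Prob n k t E * ι ((suc k ℕ.^ n) ℕ.^ t) ≡ ι (Outcomes.μ k n t E)
  Prob-scaled n k t E = go (allVecs (allVecs bools n) t)
    where
    go : ∀ ωs → sumWeights k E ωs * ι ((suc k ℕ.^ n) ℕ.^ t) ≡
                ι (∑ ωs (λ ω → if E ω then Outcomes.∏ k n ω else 0))
    go []       = *-zeroˡ (ι ((suc k ℕ.^ n) ℕ.^ t))
    go (ω ∷ ωs) with E ω
    ... | true  = trans (*-distribʳ-+ (ι ((suc k ℕ.^ n) ℕ.^ t)) (outcomeWeight k ω) (sumWeights k E ωs))
                  (trans (cong₂ _+_ (outcomeWeight-scaled k ω) (go ωs)) (sym (ι-+ (Outcomes.∏ k n ω) _)))
    ... | false = go ωs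

module Algorithm where

  open import Data.Bool using (Bool; true; not)
  open import Data.Bool.ListAction using (any)
  open import Data.Bool.Properties using (not-injective)
  open import Data.Empty using (⊥-elim)
  open import Data.Fin using (Fin)
  open import Data.Fin.Properties using (_≟_)
  open import Data.Fin.Subset using (Subset; _∈_; _∉_; ⁅_⁆; _∪_; _-_; ∣_∣)
  open import Data.Fin.Subset.Properties
    using (x∈⁅x⁆; x∈⁅y⁆⇒x≡y; ∣⁅x⁆∣≡1; x∈p∪q⁺; x∈p∪q⁻; x∈p∧x≢y⇒x∈p-y; x∈p⇒∣p-x∣<∣p∣)
  open import Data.List using (allFin)
  open import Data.List.Membership.Propositional.Properties using (∈-allFin)
  open import Data.Nat hiding (_≟_)
  open import Data.Nat.Logarithm using (⌈log₂_⌉)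
  open import Data.Nat.Properties hiding (_≟_)
  open import Data.Nat.Tactic.RingSolver using (solve-∀)
  open import Data.Product using (Σ; _×_; _,_; proj₁; proj₂)
  open import Data.Integer using (+_)
  import Data.Rational as ℚ
  open import Data.Sum using (inj₁; inj₂)
  open import Data.Vec using (Vec; lookup)
  open import Function using (_∘_)
  open import Relation.Binary.PropositionalEquality
  open import Relation.Nullary using (¬_; yes; no)
  open import Defs
  open Sums
  open Arithmetic
  open TreeDecompositions
  open Sampling
  open Rationals using (Prob-scaled; 1-1/[1+M]≤p)

  Output-⊇ : ∀ {n t} (G : Graph n) → Irreflexive G → (ω : Vec (Subset n) t) → Supergraph G (Output G ω)
  Output-⊇ G irreflexive ω u v Guv =
    (λ { refl → irreflexive u Guv }) , λ _ (u∈Q , v∈Q , ¬connected) → ¬connected (step u∈Q Guv (here v∈Q))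

  module Amplification {n : ℕ} {G : Graph n} (D : TreeDecomposition G) (k : ℕ) (narrow : WidthAtMost D k) where

    open TreeDecomposition D using (bag; covers)
    open Separation D
    module S = Subsets k
    module Ω = Outcomes k n

    -- Pairs sharing a bag need no separation, so any bag of u serves for them.
    separator : ∀ u v → Σ Node λ i → u ∈ bag i × (¬ Share u v → Separates u v i)
    separator u v with share? u v
    ... | yes share = proj₁ (covers u) , proj₂ (covers u) , λ ¬share → ⊥-elim (¬share share)
    ... | no ¬share = let (i , u∈i , separates) = separate ¬share in i , u∈i , λ _ → separates

    good : Fin n → Fin n → Subset n → Bool
    good u v = cylinder (⁅ u ⁆ ∪ ⁅ v ⁆) (bag (proj₁ (separator u v)) - u)

    missed : ∀ {t} → Fin n → Fin n → Vec (Subset n) t → Bool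
    missed u v = every (not ∘ good u v)

    failure : ∀ {t} → Vec (Subset n) t → Bool
    failure ω = any (λ u → any (λ v → missed u v ω) (allFin n)) (allFin n)

    success : ∀ {t} → Vec (Subset n) t → Bool
    success = not ∘ failure

    covered⇒TwAtMost : ∀ {H : Graph n} → (∀ u v → H u v → Share u v) → TwAtMost H k
    covered⇒TwAtMost covered =
      record { TreeDecomposition D using (m; T; isTree; bag; covers; subtree) ; edges = covered } , narrow

    success⇒TwAtMost : ∀ {t} (ω : Vec (Subset n) t) → success ω ≡ true → TwAtMost (Output G ω) k
    success⇒TwAtMost ω succeeded = covered⇒TwAtMost covered
      where
      covered : ∀ u v → Output G ω u v → Share u v
      covered u v (_ , kept) with share? u v
      ... | yes share = share
      ... | no ¬share with every-false _ ω (any-false _ (any-false _ (not-injective succeeded) (∈-allFin u))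
                                                          (∈-allFin v))
      ...   | j , not-good = ⊥-elim (kept j (u∈Q , v∈Q , cut Q Q∩i⊆u))
        where
        Q : Subset n
        Q = lookup ω j
        i : Node
        i = proj₁ (separator u v)
        v∉i : v ∉ bag i
        v∉i = proj₁ (proj₂ (proj₂ (separator u v)) ¬share)
        cut : ∀ Q → (∀ z → z ∈ Q → z ∈ bag i → z ≡ u) → ¬ ConnIn G Q u v
        cut = proj₂ (proj₂ (proj₂ (separator u v)) ¬share)
        hit : good u v Q ≡ true
        hit = not-injective not-good
        u∈Q : u ∈ Q
        u∈Q = cylinder-⊇ hit (x∈p∪q⁺ (inj₁ (x∈⁅x⁆ u)))
        v∈Q : v ∈ Q
        v∈Q = cylinder-⊇ hit (x∈p∪q⁺ {p = ⁅ u ⁆} (inj₂ (x∈⁅x⁆ v)))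
        Q∩i⊆u : ∀ z → z ∈ Q → z ∈ bag i → z ≡ u
        Q∩i⊆u z z∈Q z∈i with z ≟ u
        ... | yes z≡u = z≡u
        ... | no  z≢u with x∈p∪q⁻ ⁅ u ⁆ ⁅ v ⁆ (cylinder-∩ hit (x∈p∧x≢y⇒x∈p-y z∈i z≢u) z∈Q)
        ...   | inj₁ z∈u = x∈⁅y⁆⇒x≡y u z∈u
        ...   | inj₂ z∈v = ⊥-elim (v∉i (subst (_∈ bag i) (x∈⁅y⁆⇒x≡y v z∈v) z∈i))

    μ-good-≥ : ∀ u v → suc k ^ n ≤ 4 * suc k ^ 2 * S.μ n (good u v)
    μ-good-≥ u v = μ-cylinder-≥ k (⁅ u ⁆ ∪ ⁅ v ⁆) (bag i - u) ∣I∣≤2 ∣O∣≤k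
      where
      i : Node
      i = proj₁ (separator u v)
      ∣I∣≤2 : ∣ ⁅ u ⁆ ∪ ⁅ v ⁆ ∣ ≤ 2
      ∣I∣≤2 = ≤-trans (∣p∪q∣≤∣p∣+∣q∣ ⁅ u ⁆ ⁅ v ⁆) (≤-reflexive (cong₂ _+_ (∣⁅x⁆∣≡1 u) (∣⁅x⁆∣≡1 v)))
      ∣O∣≤k : ∣ (bag i - u) ∣ ≤ k
      ∣O∣≤k = s≤s⁻¹ (<-≤-trans (x∈p⇒∣p-x∣<∣p∣ (proj₁ (proj₂ (separator u v)))) (narrow i))

    μ-missed : ∀ u v s → 2 ^ s * Ω.μ (4 * suc k ^ 2 * s) (missed u v) ≤ (suc k ^ n) ^ (4 * suc k ^ 2 * s)
    μ-missed u v s = begin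
      2 ^ s * Ω.μ (m * s) (missed u v)   ≡⟨ cong (2 ^ s *_) (Ω.μ-every (m * s) (not ∘ good u v)) ⟩
      2 ^ s * b ^ (m * s)                ≡⟨ cong (2 ^ s *_) (^-*-assoc b m s) ⟨
      2 ^ s * (b ^ m) ^ s                ≤⟨ 2^s*a^s≤b^s s (2*b^m≤[b+g]^m b g m b+g≤m*g 0<b+g) ⟩
      ((b + g) ^ m) ^ s                  ≡⟨ ^-*-assoc (b + g) m s ⟩
      (b + g) ^ (m * s)                  ≡⟨ cong (_^ (m * s)) b+g≡K ⟩
      (suc k ^ n) ^ (m * s)              ∎
      where
      open ≤-Reasoning
      m g b : ℕ
      m = 4 * suc k ^ 2
      g = S.μ n (good u v)
      b = S.μ n (not ∘ good u v)
      b+g≡K : b + g ≡ suc k ^ n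
      b+g≡K = trans (+-comm b g) (trans (S.μ-∁ n (good u v)) (Subsets-total k n))
      b+g≤m*g : b + g ≤ m * g
      b+g≤m*g = ≤-trans (≤-reflexive b+g≡K) (μ-good-≥ u v)
      0<b+g : 0 < b + g
      0<b+g = ≤-trans (m^n>0 (suc k) n) (≤-reflexive (sym b+g≡K))

    μ-failure : ∀ s →
                2 ^ s * Ω.μ (4 * suc k ^ 2 * s) failure ≤ n * (n * (suc k ^ n) ^ (4 * suc k ^ 2 * s))
    μ-failure s = ≤-trans (*-monoʳ-≤ (2 ^ s) union)
      (*-∑-allFin-≤ (2 ^ s) _ (λ u → *-∑-allFin-≤ (2 ^ s) _ (λ v → μ-missed u v s)))
      where
      t : ℕ
      t = 4 * suc k ^ 2 * s
      union : Ω.μ t failure ≤ ∑ (allFin n) (λ u → ∑ (allFin n) (λ v → Ω.μ t (missed u v)))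
      union = ≤-trans (Ω.μ-any t (allFin n) (λ u ω → any (λ v → missed u v ω) (allFin n)))
                      (∑-mono-≤ (allFin n) (λ u → Ω.μ-any t (allFin n) (missed u)))

    -- 4(k+1)² queries halve the probability of missing a pair, and 3(1 + ⌈log₂ n⌉) halvings
    -- beat the factor n³ lost in the union bound and in M ≤ n.
    rounds : ℕ
    rounds = 12 * suc k ^ 2 * suc ⌈log₂ n ⌉

    failure-rare : ∀ M → suc M ≤ n → suc M * Ω.μ rounds failure ≤ (suc k ^ n) ^ rounds
    failure-rare M 1+M≤n = *-cancelˡ-≤ (n * n) {{m*n≢0 n n {{n≢0}} {{n≢0}}}} (begin
      n * n * (suc M * F)   ≤⟨ *-monoʳ-≤ (n * n) (*-monoˡ-≤ F 1+M≤n) ⟩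
      n * n * (n * F)       ≡⟨ e n F ⟩
      n * (n * n) * F       ≤⟨ *-monoˡ-≤ F (n³≤2^[3*[1+⌈log₂n⌉]] n) ⟩
      2 ^ s * F             ≤⟨ subst (λ t → 2 ^ s * Ω.μ t failure ≤ n * (n * (suc k ^ n) ^ t))
                                     rounds≡ (μ-failure s) ⟩
      n * (n * (suc k ^ n) ^ rounds) ≡⟨ *-assoc n n _ ⟨
      n * n * (suc k ^ n) ^ rounds   ∎)
      where
      open ≤-Reasoning
      s F : ℕ
      s = 3 * suc ⌈log₂ n ⌉
      F = Ω.μ rounds failure
      n≢0 : NonZero n
      n≢0 = >-nonZero (≤-trans (s≤s z≤n) 1+M≤n)
      rounds≡ : 4 * suc k ^ 2 * s ≡ rounds
      rounds≡ = e′ (suc k ^ 2) (suc ⌈log₂ n ⌉)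
        where
        e′ : ∀ x y → 4 * x * (3 * y) ≡ 12 * x * y
        e′ = solve-∀
      e : ∀ n F → n * n * (n * F) ≡ n * (n * n) * F
      e = solve-∀

    Prob-success : ∀ M → suc M ≤ n → ℚ.1ℚ ℚ.- + 1 ℚ./ suc M ℚ.≤ Prob n k rounds success
    Prob-success M 1+M≤n = 1-1/[1+M]≤p (Prob n k rounds success) M (Prob-scaled n k rounds success)
      (trans (Ω.μ-∁ rounds failure) (Outcomes-total k n rounds)) (failure-rare M 1+M≤n)
      (m^n>0 (suc k ^ n) {{m^n≢0 (suc k) n}} rounds)

open import Defs
open import Data.Nat using (ℕ; suc; _*_; _^_; _≤_)
open import Data.Nat.Logarithm using (⌈log₂_⌉)
open import Data.Fin.Subset using (Subset)
open import Data.Vec using (Vec)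
open import Data.Bool using (Bool; true)
open import Data.Product using (Σ; _×_)
open import Data.Rational using (ℚ; 0ℚ; 1ℚ; _-_) renaming (_≤_ to _≤ℚ_; _<_ to _<ℚ_)
open import Relation.Binary.PropositionalEquality using (_≡_)

open import Data.Product using (_,_)
open import Data.Rational.Properties using (≤-trans; +-monoʳ-≤; neg-antimono-≤)
open Rationals using (1/[1+M]≤ε)
open Algorithm using (Output-⊇; module Amplification)

lemma5 : Σ ℕ λ c → ∀ (ε : ℚ) → 0ℚ <ℚ ε → Σ ℕ λ N → ∀ (n : ℕ) → N ≤ n →
    ∀ (k : ℕ) (G : Graph n) → Symmetric G → Irreflexive G → TwAtMost G k →
    let t = c * (suc k ^ 2) * suc ⌈log₂ n ⌉ in
      (∀ (ω : Vec (Subset n) t) → Supergraph G (Output G ω))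
      × (Σ (Vec (Subset n) t → Bool) λ E →
          (∀ (ω : Vec (Subset n) t) → E ω ≡ true → TwAtMost (Output G ω) k)
          × (1ℚ - ε ≤ℚ Prob n k t E))
lemma5 = 12 , λ ε 0<ε →
  let (M , 1/[1+M]≤ε) = 1/[1+M]≤ε ε 0<ε in
  suc M , λ n 1+M≤n k G _ irreflexive (D , narrow) →
    let open Amplification D k narrow in
    Output-⊇ G irreflexive , success , success⇒TwAtMost ,
    ≤-trans (+-monoʳ-≤ 1ℚ (neg-antimono-≤ 1/[1+M]≤ε)) (Prob-success M 1+M≤n)
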